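{- Let $G_0$ be a finite connected graph and let $(G_t)_{t\ge 0}$ be the sequence of graphs generated by the Iterated Local Transitivity (ILT) model with initial graph $G_0$. Let $t\ge 1$ and $k=b(G_0)$. If $G_0$ has an optimal burning sequence $(x_1,\dots,x_k)$ in which $x_k$ has a neighbour that becomes burned in round $k-1$, then $b(G_t)=b(G_0)$. Otherwise, $b(G_t)=b(G_0)+1$.
   Context: Burning process on a finite simple graph $G$: in round 1 one node is chosen and burned. In each round $t\ge 2$, every unburned neighbour of a node burned by the end of round $t-1$ becomes burned, and in addition one unburned node (if available) is chosen and burned; burned nodes stay burned. If the chosen nodes are $x_1,\dots,x_k$ ($x_i$ chosen in round $i$ while unburned) and all nodes are burned at the end of round $k$, then $(x_1,\dots,x_k)$ is a burning sequence. The burning number $b(G)$ is the minimum length of a burning sequence of $G$; a burning sequence of length $b(G)$ is optimal. ILT model: given $G_t$, the graph $G_{t+1}$ is obtained by adding, for each node $x\in V(G_t)$, a new node $x'$ (its clone) adjacent to $x$ and to all neighbours of $x$ in $G_t$; the new nodes form an independent set. -}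

module Defs where

open import Data.Nat using (ℕ; zero; suc; _+_; _∸_; _≤_; _<_)
open import Data.Fin using (Fin; splitAt)
open import Data.List using (List; length; _++_; [_]; lookup)
open import Data.Product using (Σ; ∃; _×_; _,_)
open import Data.Sum using (_⊎_; inj₁; inj₂)
open import Data.Empty using (⊥)
open import Data.Fin.Properties using (_≟_)
open import Relation.Nullary using (¬_; Dec; yes; no)
open import Relation.Binary.PropositionalEquality using (_≡_; refl; sym)
open import Relation.Binary.Construct.Closure.ReflexiveTransitive using (Star)
import Data.Sum.Properties

record Graph : Set₁ where
  field
    n      : ℕ
    Adj    : Fin n → Fin n → Set
    adj?   : ∀ x y → Dec (Adj x y)
    symm   : ∀ {x y} → Adj x y → Adj y x
    irrefl : ∀ x → ¬ Adj x x
open Graph public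

Connected : Graph → Set
Connected G = (0 < n G) × (∀ u v → Star (Adj G) u v)

-- ILT model.  Vertices of the new graph: Fin (n + n); the first n are the
-- old vertices x, the vertex  n + x  is the clone x'.

module _ (G : Graph) where
  private
    N = n G
    A = Adj G

  ILTadj : Fin N ⊎ Fin N → Fin N ⊎ Fin N → Set
  ILTadj (inj₁ x) (inj₁ y) = A x y
  ILTadj (inj₁ x) (inj₂ y) = (x ≡ y) ⊎ A x y
  ILTadj (inj₂ x) (inj₁ y) = (x ≡ y) ⊎ A x y
  ILTadj (inj₂ x) (inj₂ y) = ⊥

  private
    dec⊎ : ∀ {P Q : Set} → Dec P → Dec Q → Dec (P ⊎ Q)
    dec⊎ (yes p) _ = yes (inj₁ p)
    dec⊎ (no _) (yes q) = yes (inj₂ q)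
    dec⊎ (no ¬p) (no ¬q) = no λ { (inj₁ p) → ¬p p ; (inj₂ q) → ¬q q }

  ILTadj? : ∀ a b → Dec (ILTadj a b)
  ILTadj? (inj₁ x) (inj₁ y) = adj? G x y
  ILTadj? (inj₁ x) (inj₂ y) = dec⊎ (x ≟ y) (adj? G x y)
  ILTadj? (inj₂ x) (inj₁ y) = dec⊎ (x ≟ y) (adj? G x y)
  ILTadj? (inj₂ x) (inj₂ y) = no λ ()

  ILTsym : ∀ {a b} → ILTadj a b → ILTadj b a
  ILTsym {inj₁ x} {inj₁ y} p = symm G p
  ILTsym {inj₁ x} {inj₂ y} (inj₁ e) = inj₁ (sym e)
  ILTsym {inj₁ x} {inj₂ y} (inj₂ p) = inj₂ (symm G p)
  ILTsym {inj₂ x} {inj₁ y} (inj₁ e) = inj₁ (sym e)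
  ILTsym {inj₂ x} {inj₁ y} (inj₂ p) = inj₂ (symm G p)

  ILTirr : ∀ a → ¬ ILTadj a a
  ILTirr (inj₁ x) p = irrefl G x p
  ILTirr (inj₂ x) ()

  ILT : Graph
  ILT = record
    { n      = N + N
    ; Adj    = λ u v → ILTadj (splitAt N u) (splitAt N v)
    ; adj?   = λ u v → ILTadj? (splitAt N u) (splitAt N v)
    ; symm   = λ {u} {v} → ILTsym {splitAt N u} {splitAt N v}
    ; irrefl = λ u → ILTirr (splitAt N u)
    }

ILT^ : ℕ → Graph → Graph
ILT^ zero G = G
ILT^ (suc t) G = ILT (ILT^ t G)

-- For a list xs = (x_1,…,x_k) of chosen vertices,
-- Burned G xs t v  means: v is burned at the end of round t.
-- Round t+1: neighbours of burned vertices burn, and x_{t+1} (if any) is burned.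

lookupℕ : ∀ {A : Set} → List A → ℕ → A → Set
lookupℕ List.[] _ a = ⊥
lookupℕ (List._∷_ x xs) zero a = x ≡ a
lookupℕ (List._∷_ x xs) (suc i) a = lookupℕ xs i a

Burned : (G : Graph) → List (Fin (n G)) → ℕ → Fin (n G) → Set
Burned G xs zero v = ⊥
Burned G xs (suc t) v =
  Burned G xs t v
  ⊎ (∃ λ u → Adj G u v × Burned G xs t u)
  ⊎ lookupℕ xs t v

IsBurningSeq : (G : Graph) → List (Fin (n G)) → Set
IsBurningSeq G xs =
  (∀ (i : Fin (length xs)) →
      ¬ Burned G xs (Data.Fin.toℕ i) (lookup xs i))
  × (∀ v → Burned G xs (length xs) v)

BurningNumber : Graph → ℕ → Set
BurningNumber G k =
  (∃ λ xs → IsBurningSeq G xs × length xs ≡ k)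
  × (∀ xs → IsBurningSeq G xs → k ≤ length xs)

GoodOptimal : Graph → ℕ → Set
GoodOptimal G k =
  Σ (List (Fin (n G))) λ ys → Σ (Fin (n G)) λ x → Σ (Fin (n G)) λ w →
    IsBurningSeq G (ys ++ [ x ])
    × length (ys ++ [ x ]) ≡ k
    × Adj G x w
    × Burned G (ys ++ [ x ]) (length ys) w
    × ¬ Burned G (ys ++ [ x ]) (length ys ∸ 1) w

module Submission where

-- Call a list ys of length m a *spread cover* of G if every vertex is burned
-- at the end of round m + 1 when the nodes ys are set on fire (no further
-- node is chosen in round m + 1); the chosen nodes need not be unburned when
-- chosen.  The proof rests on three facts.
--   * Repair: any list of sources can be turned into a genuine burning
--     sequence (every choice unburned) that burns at least as much, so a
--     spread cover of length m yields b(G) ≤ m + 1; and when b(G) = m + 1 it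
--     yields an optimal sequence whose last node has a neighbour burned in
--     round m, i.e. GoodOptimal G (m + 1).  Conversely GoodOptimal G (m + 1)
--     gives a spread cover of length m.
--   * Covers: G_t retracts onto G_0 (π : G_t → G_0, emb : G_0 → G_t) so that
--     burning projects along π (hence b(G_t) ≥ b(G_0)) and spread covers lift
--     along emb, since every clone lies in the closed neighbourhood of its
--     original.
--   * For t ≥ 1 every fibre of π has two points, so a burning sequence of G_t
--     of length m + 1 minus its last choice projects to a spread cover of G_0.
-- The theorem follows: spread covers of length b(G_0) - 1 exist exactly in
-- the good case, and those of length b(G_0) always exist.

open import Defs
open import Data.Nat using (ℕ; zero; suc; _∸_; _≤_; _<_; _≥_; s≤s; z≤n)
open import Data.Nat.Properties
  using (≤-refl; ≤-trans; ≤-reflexive; ≤-antisym; n≤1+n; m≤n⇒m≤1+n; <⇒≤; 1+n≰n; n≮n; suc-injective; m≤n⇒m<n∨m≡n)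
open import Data.Fin using (Fin; toℕ; fromℕ<; splitAt; _↑ˡ_; _↑ʳ_)
open import Data.Fin.Properties using (_≟_; any?; all?; ¬∀⟶∃¬; splitAt-↑ˡ; splitAt-↑ʳ; splitAt⁻¹-↑ˡ)
open import Data.List using (List; []; _∷_; length; _++_; [_]; lookup; map)
open import Data.List.Properties using (length-map)
open import Data.List.Reverse using (Reverse; []; _∶_∶ʳ_; reverseView)
open import Data.Product using (∃; ∃₂; _×_; _,_)
import Data.Product as Product
open import Data.Sum using (_⊎_; inj₁; inj₂; reduce)
import Data.Sum as Sum
open import Data.Empty using (⊥-elim)
open import Function using (id; _∘_)
open import Relation.Nullary using (¬_; Dec; yes; no)
open import Relation.Nullary.Decidable using (_×-dec_; _⊎-dec_)
open import Relation.Unary using (_⊆_)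
open import Relation.Binary.PropositionalEquality using (_≡_; _≢_; refl; sym; trans; cong; subst)

module _ {A : Set} where

  length-snoc : ∀ (xs : List A) x → length (xs ++ [ x ]) ≡ suc (length xs)
  length-snoc []       x = refl
  length-snoc (y ∷ xs) x = cong suc (length-snoc xs x)

  lookupℕ-lookup : ∀ (xs : List A) i → lookupℕ xs (toℕ i) (lookup xs i)
  lookupℕ-lookup (x ∷ xs) Fin.zero    = refl
  lookupℕ-lookup (x ∷ xs) (Fin.suc i) = lookupℕ-lookup xs i

  lookupℕ-< : ∀ (xs : List A) {i a} → lookupℕ xs i a → i < length xs
  lookupℕ-< (x ∷ xs) {zero}  _ = s≤s z≤n
  lookupℕ-< (x ∷ xs) {suc i} l = s≤s (lookupℕ-< xs l)

  lookupℕ-beyond : ∀ (xs : List A) {m a} → length xs ≡ m → ¬ lookupℕ xs m a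
  lookupℕ-beyond xs refl l = n≮n _ (lookupℕ-< xs l)

  lookupℕ-++ : ∀ (xs zs : List A) {i a} → lookupℕ xs i a → lookupℕ (xs ++ zs) i a
  lookupℕ-++ (x ∷ xs) zs {zero}  e = e
  lookupℕ-++ (x ∷ xs) zs {suc i} l = lookupℕ-++ xs zs l

  lookupℕ-++⁻ : ∀ (xs zs : List A) {i a} → i < length xs → lookupℕ (xs ++ zs) i a → lookupℕ xs i a
  lookupℕ-++⁻ (x ∷ xs) zs {zero}  _       e = e
  lookupℕ-++⁻ (x ∷ xs) zs {suc i} (s≤s p) l = lookupℕ-++⁻ xs zs p l

  lookupℕ-last : ∀ (xs : List A) x → lookupℕ (xs ++ [ x ]) (length xs) x
  lookupℕ-last []       x = refl
  lookupℕ-last (y ∷ xs) x = lookupℕ-last xs x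

  lookupℕ-snoc : ∀ (xs : List A) x {i a} → lookupℕ (xs ++ [ x ]) i a →
                 lookupℕ xs i a ⊎ (i ≡ length xs × x ≡ a)
  lookupℕ-snoc []       x {zero}  e  = inj₂ (refl , e)
  lookupℕ-snoc (y ∷ xs) x {zero}  e  = inj₁ e
  lookupℕ-snoc (y ∷ xs) x {suc i} l  = Sum.map₂ (Product.map₁ (cong suc)) (lookupℕ-snoc xs x l)

lookupℕ-map : ∀ {A B : Set} (f : A → B) (xs : List A) {i a} → lookupℕ xs i a → lookupℕ (map f xs) i (f a)
lookupℕ-map f (x ∷ xs) {zero}  e = cong f e
lookupℕ-map f (x ∷ xs) {suc i} l = lookupℕ-map f xs l

lookupℕ? : ∀ {n} (xs : List (Fin n)) i a → Dec (lookupℕ xs i a)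
lookupℕ? []       i       a = no λ ()
lookupℕ? (x ∷ xs) zero    a = x ≟ a
lookupℕ? (x ∷ xs) (suc i) a = lookupℕ? xs i a

Near : (G : Graph) → Fin (n G) → Fin (n G) → Set
Near G p q = p ≡ q ⊎ Adj G p q

Burnable : Graph → ℕ → Set
Burnable G k = ∃ λ xs → IsBurningSeq G xs × length xs ≤ k

Minimal : Graph → ℕ → Set
Minimal G k = ∀ xs → IsBurningSeq G xs → k ≤ length xs

SpreadBurnable : Graph → ℕ → Set
SpreadBurnable G m = ∃ λ ys → length ys ≡ m × (∀ v → Burned G ys (suc m) v)

module _ (G : Graph) where

  burned? : ∀ xs r v → Dec (Burned G xs r v)
  burned? xs zero    v = no λ ()
  burned? xs (suc r) v =
    burned? xs r v ⊎-dec (any? (λ u → adj? G u v ×-dec burned? xs r u) ⊎-dec lookupℕ? xs r v)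

  allOrUnburned : ∀ xs r → (∀ v → Burned G xs r v) ⊎ ∃ λ v → ¬ Burned G xs r v
  allOrUnburned xs r with all? (burned? xs r)
  ... | yes all = inj₁ all
  ... | no ¬all = inj₂ (¬∀⟶∃¬ (n G) (Burned G xs r) (burned? xs r) ¬all)

  Valid : List (Fin (n G)) → Set
  Valid xs = ∀ i {a} → lookupℕ xs i a → ¬ Burned G xs i a

  burningSeq : ∀ {xs m} → Valid xs → length xs ≡ m → (∀ v → Burned G xs m v) → IsBurningSeq G xs
  burningSeq {xs} valid refl covers = (λ i → valid (toℕ i) (lookupℕ-lookup xs i)) , covers

  burnsNear : ∀ {xs r u v} → Burned G xs r u → Near G u v → Burned G xs (suc r) v
  burnsNear b (inj₁ refl) = inj₁ b
  burnsNear b (inj₂ adj)  = inj₂ (inj₁ (_ , adj , b))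

  burnsFromPrevious : ∀ {xs} r {u v} → Burned G xs (r ∸ 1) u → Adj G u v → Burned G xs r v
  burnsFromPrevious (suc r) b adj = burnsNear b (inj₂ adj)

  spreadMono : ∀ {ys xs r} → Burned G ys r ⊆ Burned G xs r →
               (∀ {v} → lookupℕ ys r v → Burned G xs (suc r) v) →
               Burned G ys (suc r) ⊆ Burned G xs (suc r)
  spreadMono dom new (inj₁ b)                  = inj₁ (dom b)
  spreadMono dom new (inj₂ (inj₁ (u , a , b))) = inj₂ (inj₁ (u , a , dom b))
  spreadMono dom new (inj₂ (inj₂ l))           = new l

  burned-++ : ∀ xs zs r → Burned G xs r ⊆ Burned G (xs ++ zs) r
  burned-++ xs zs zero    ()
  burned-++ xs zs (suc r) = spreadMono (burned-++ xs zs r) (inj₂ ∘ inj₂ ∘ lookupℕ-++ xs zs)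

  burned-prefix : ∀ xs zs {r} → r ≤ length xs → Burned G (xs ++ zs) r ⊆ Burned G xs r
  burned-prefix xs zs {zero}  _  ()
  burned-prefix xs zs {suc r} le =
    spreadMono (burned-prefix xs zs (≤-trans (n≤1+n r) le)) (inj₂ ∘ inj₂ ∘ lookupℕ-++⁻ xs zs le)

  lastChoice : ∀ {xs x m v} → length xs ≡ m → Burned G (xs ++ [ x ]) (suc m) v → Burned G xs (suc m) v ⊎ x ≡ v
  lastChoice {xs} refl (inj₁ b)                  = inj₁ (inj₁ (burned-prefix xs _ ≤-refl b))
  lastChoice {xs} refl (inj₂ (inj₁ (u , a , b))) = inj₁ (inj₂ (inj₁ (u , a , burned-prefix xs _ ≤-refl b)))
  lastChoice {xs} {x} refl (inj₂ (inj₂ l)) with lookupℕ-snoc xs x l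
  ... | inj₁ l'      = ⊥-elim (lookupℕ-beyond xs refl l')
  ... | inj₂ (_ , e) = inj₂ e

  validSnoc : ∀ {xs x m} → Valid xs → length xs ≡ m → ¬ Burned G xs m x → Valid (xs ++ [ x ])
  validSnoc {xs} {x} valid refl unburned i l b with lookupℕ-snoc xs x l
  ... | inj₁ l'           = valid i l' (burned-prefix xs [ x ] (<⇒≤ (lookupℕ-< xs l')) b)
  ... | inj₂ (refl , refl) = unburned (burned-prefix xs [ x ] ≤-refl b)

  Repaired : ℕ → List (Fin (n G)) → Set
  Repaired m ys = Burnable G m
                ⊎ ∃ λ xs → Valid xs × length xs ≡ m × Burned G ys m ⊆ Burned G xs m

  nextChoice : ∀ xs m y {v} → ¬ Burned G xs m v →
               ∃ λ x → ¬ Burned G xs m x × (Burned G xs m y ⊎ x ≡ y)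
  nextChoice xs m y {v} unburnedV with burned? xs m y
  ... | yes burnedY  = v , unburnedV , inj₁ burnedY
  ... | no unburnedY = y , unburnedY , inj₂ refl

  repairStep : ∀ {m ys} y → length ys ≡ m → Repaired m ys → Repaired (suc m) (ys ++ [ y ])
  repairStep y lys (inj₁ (zs , ibs , le)) = inj₁ (zs , ibs , m≤n⇒m≤1+n le)
  repairStep {m} {ys} y lys (inj₂ (xs , valid , lxs , dom)) with allOrUnburned xs m
  ... | inj₁ all = inj₁ (xs , burningSeq valid lxs all , ≤-trans (≤-reflexive lxs) (n≤1+n m))
  ... | inj₂ (v , unburnedV) with nextChoice xs m y unburnedV
  ... | x , unburned , yCovered =
      inj₂ (xs ++ [ x ] , validSnoc valid lxs unburned , trans (length-snoc xs x) (cong suc lxs) , dom′)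
      where
      yBurned : Burned G xs m y ⊎ x ≡ y → Burned G (xs ++ [ x ]) (suc m) y
      yBurned (inj₁ b)    = inj₁ (burned-++ xs [ x ] m b)
      yBurned (inj₂ refl) = inj₂ (inj₂ (subst (λ i → lookupℕ (xs ++ [ x ]) i x) lxs (lookupℕ-last xs x)))

      dom′ : Burned G (ys ++ [ y ]) (suc m) ⊆ Burned G (xs ++ [ x ]) (suc m)
      dom′ b with lastChoice lys b
      ... | inj₁ b′   = burned-++ xs [ x ] (suc m) (spreadMono dom (⊥-elim ∘ lookupℕ-beyond ys lys) b′)
      ... | inj₂ refl = yBurned yCovered

  repair : ∀ {ys} → Reverse ys → Repaired (length ys) ys
  repair []               = inj₂ ([] , (λ _ ()) , refl , λ ())
  repair (ys ∶ rev ∶ʳ y) =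
    subst (λ m → Repaired m (ys ++ [ y ])) (sym (length-snoc ys y)) (repairStep y refl (repair rev))

  repairCover : ∀ {ys m} → length ys ≡ m → (∀ v → Burned G ys m v) → Burnable G m
  repairCover {ys} refl covers with repair (reverseView ys)
  ... | inj₁ short                  = short
  ... | inj₂ (xs , valid , lxs , dom) = xs , burningSeq valid lxs (dom ∘ covers) , ≤-reflexive lxs

  repairSpread : ∀ {m} → SpreadBurnable G m →
                 Burnable G m ⊎ ∃ λ xs → Valid xs × length xs ≡ m × (∀ v → Burned G xs (suc m) v)
  repairSpread (ys , refl , covers) with repair (reverseView ys)
  ... | inj₁ short = inj₁ short
  ... | inj₂ (xs , valid , lxs , dom) =
    inj₂ (xs , valid , lxs , spreadMono dom (⊥-elim ∘ lookupℕ-beyond ys refl) ∘ covers)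

  spreadCompletion : ∀ {m} → SpreadBurnable G m →
    Burnable G m ⊎ ∃₂ λ xs v → ∃ λ w →
      IsBurningSeq G (xs ++ [ v ]) × length xs ≡ m × Adj G w v × Burned G xs m w × ¬ Burned G xs m v
  spreadCompletion {m} cover with repairSpread cover
  ... | inj₁ short = inj₁ short
  ... | inj₂ (xs , valid , lxs , covers) with allOrUnburned xs m
  ...   | inj₁ all = inj₁ (xs , burningSeq valid lxs all , ≤-reflexive lxs)
  ...   | inj₂ (v , unburned) with covers v
  ...     | inj₁ b                  = ⊥-elim (unburned b)
  ...     | inj₂ (inj₂ l)           = ⊥-elim (lookupℕ-beyond xs lxs l)
  ...     | inj₂ (inj₁ (w , adj , b)) = inj₂ (xs , v , w , completed , lxs , adj , b , unburned)
    where
    completed : IsBurningSeq G (xs ++ [ v ])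
    completed = burningSeq (validSnoc valid lxs unburned) (trans (length-snoc xs v) (cong suc lxs))
                           (λ u → burned-++ xs [ v ] (suc m) (covers u))

  spreadBurnable⇒burnable : ∀ {m} → SpreadBurnable G m → Burnable G (suc m)
  spreadBurnable⇒burnable cover with spreadCompletion cover
  ... | inj₁ (xs , ibs , le) = xs , ibs , m≤n⇒m≤1+n le
  ... | inj₂ (xs , v , _ , ibs , lxs , _) = xs ++ [ v ] , ibs , ≤-reflexive (trans (length-snoc xs v) (cong suc lxs))

  spread⇒good : ∀ {m} → Minimal G (suc m) → SpreadBurnable G m → GoodOptimal G (suc m)
  spread⇒good minimal cover with spreadCompletion cover
  ... | inj₁ (xs , ibs , le) = ⊥-elim (1+n≰n (≤-trans (minimal xs ibs) le))
  ... | inj₂ (xs , v , w , ibs , refl , adj , burnedW , unburnedV) =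
    xs , v , w , ibs , trans (length-snoc xs v) refl , symm G adj ,
    burned-++ xs [ v ] (length xs) burnedW ,
    λ earlier → unburnedV (burned-prefix xs [ v ] ≤-refl (burnsFromPrevious (length xs) earlier adj))

  good⇒spread : ∀ {m} → GoodOptimal G (suc m) → SpreadBurnable G m
  good⇒spread {m} (ys , x , w , (_ , covers) , len , adj , burnedW , _) = ys , lys , spread
    where
    lys : length ys ≡ m
    lys = suc-injective (trans (sym (length-snoc ys x)) len)

    spread : ∀ u → Burned G ys (suc m) u
    spread u with lastChoice lys (subst (λ r → Burned G (ys ++ [ x ]) r u) len (covers u))
    ... | inj₁ b    = b
    ... | inj₂ refl = burnsNear (subst (λ r → Burned G ys r w) lys (burned-prefix ys [ x ] ≤-refl burnedW))
                                (inj₂ (symm G adj))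

  burning⇒spread : ∀ {k} → BurningNumber G k → SpreadBurnable G k
  burning⇒spread ((xs , (_ , covers) , refl) , _) = xs , refl , inj₁ ∘ covers

record Cover (H G : Graph) : Set where
  field
    π     : Fin (n H) → Fin (n G)
    emb   : Fin (n G) → Fin (n H)
    π∘emb : ∀ p → π (emb p) ≡ p
    nearπ   : ∀ {a b} → Adj H a b → Near G (π a) (π b)
    nearEmb : ∀ {p a} → Near G p (π a) → Near H (emb p) a

-- Every fibre of π has at least two points: it avoids any given vertex.
Redundant : ∀ {H G} → Cover H G → Set
Redundant {H} {G} C = ∀ p (b : Fin (n H)) → ∃ λ a → π a ≡ p × a ≢ b
  where open Cover C

module _ {H G : Graph} (C : Cover H G) where
  open Cover C

  nearπ⁺ : ∀ {a b} → Near H a b → Near G (π a) (π b)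
  nearπ⁺ (inj₁ refl) = inj₁ refl
  nearπ⁺ (inj₂ adj)  = nearπ adj

  project : ∀ {zs r a} → Burned H zs r a → Burned G (map π zs) r (π a)
  project {r = suc r} (inj₁ b)                  = inj₁ (project b)
  project {r = suc r} (inj₂ (inj₁ (u , adj , b))) = burnsNear G (project b) (nearπ adj)
  project {zs} {suc r} (inj₂ (inj₂ l))         = inj₂ (inj₂ (lookupℕ-map π zs l))

  embBurned : ∀ {xs r p} → Burned G xs r p → Burned H (map emb xs) r (emb p)
  embBurned {r = suc r} (inj₁ b) = inj₁ (embBurned b)
  embBurned {r = suc r} {p} (inj₂ (inj₁ (u , adj , b))) =
    burnsNear H (embBurned b) (nearEmb (inj₂ (subst (Adj G u) (sym (π∘emb p)) adj)))
  embBurned {xs} {suc r} (inj₂ (inj₂ l)) = inj₂ (inj₂ (lookupℕ-map emb xs l))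

  coverLowerBound : ∀ {zs} → IsBurningSeq H zs → Burnable G (length zs)
  coverLowerBound {zs} (_ , covers) =
    repairCover G (length-map π zs) λ v → subst (Burned G (map π zs) (length zs)) (π∘emb v) (project (covers (emb v)))

  -- Spread covers lift: a vertex over a burned closed neighbourhood burns one round later.
  liftSpread : ∀ {m} → SpreadBurnable G m → SpreadBurnable H m
  liftSpread {m} (ys , lys , covers) = map emb ys , trans (length-map emb ys) lys , λ a → lift (covers (π a))
    where
    lift : ∀ {a} → Burned G ys (suc m) (π a) → Burned H (map emb ys) (suc m) a
    lift (inj₁ b)                  = burnsNear H (embBurned b) (nearEmb (inj₁ refl))
    lift (inj₂ (inj₁ (u , adj , b))) = burnsNear H (embBurned b) (nearEmb (inj₂ adj))
    lift (inj₂ (inj₂ l))           = ⊥-elim (lookupℕ-beyond ys lys l)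

  -- With redundant fibres, a burning sequence of H of length m + 1 (hence
  -- nonempty) minus its last choice z projects to a spread cover of G: each
  -- vertex of G has a preimage other than z, which z's choice does not burn.
  dropLastChoice : Redundant C → ∀ {zs m} → IsBurningSeq H zs → length zs ≡ suc m → SpreadBurnable G m
  dropLastChoice redundant {zs} {m} (_ , covers) len with reverseView zs
  ... | zs′ ∶ _ ∶ʳ z = map π zs′ , trans (length-map π zs′) lzs′ , spread
    where
    lzs′ : length zs′ ≡ m
    lzs′ = suc-injective (trans (sym (length-snoc zs′ z)) len)

    spread : ∀ u → Burned G (map π zs′) (suc m) u
    spread u with redundant u z
    ... | a , refl , a≢z with lastChoice H lzs′ (subst (λ r → Burned H (zs′ ++ [ z ]) r a) len (covers a))
    ...   | inj₁ b    = project b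
    ...   | inj₂ z≡a  = ⊥-elim (a≢z (sym z≡a))

idCover : ∀ G → Cover G G
idCover G = record { π = id ; emb = id ; π∘emb = λ _ → refl ; nearπ = inj₂ ; nearEmb = id }

compose : ∀ {H M G} → Cover H M → Cover M G → Cover H G
compose C D = record
  { π       = D.π ∘ C.π
  ; emb     = C.emb ∘ D.emb
  ; π∘emb   = λ p → trans (cong D.π (C.π∘emb (D.emb p))) (D.π∘emb p)
  ; nearπ   = nearπ⁺ D ∘ C.nearπ
  ; nearEmb = C.nearEmb ∘ D.nearEmb
  }
  where
  module C = Cover C
  module D = Cover D

compose-redundant : ∀ {H M G} (C : Cover H M) (D : Cover M G) → Redundant C → Redundant (compose C D)
compose-redundant C D redundant p b with redundant (Cover.emb D p) b
... | a , πa , a≢b = a , trans (cong (Cover.π D) πa) (Cover.π∘emb D p) , a≢b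

-- ILT G over G: a vertex x and its clone x' both lie over x.
module _ (G : Graph) where
  private
    N = n G

  nearReduce : ∀ u v → ILTadj G u v → Near G (reduce u) (reduce v)
  nearReduce (inj₁ x) (inj₁ y) adj = inj₂ adj
  nearReduce (inj₁ x) (inj₂ y) near = near
  nearReduce (inj₂ x) (inj₁ y) near = near

  -- An original vertex p is near every vertex over its closed neighbourhood;
  -- for a clone y' this is the very definition of the ILT adjacency.
  nearOriginal : ∀ p a → Near G p (reduce (splitAt N a)) → Near (ILT G) (p ↑ˡ N) a
  nearOriginal p a near rewrite splitAt-↑ˡ N p N with splitAt N a in eq
  nearOriginal p a (inj₁ refl) | inj₁ y = inj₁ (splitAt⁻¹-↑ˡ eq)
  nearOriginal p a (inj₂ adj)  | inj₁ y = inj₂ adj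
  nearOriginal p a near        | inj₂ y = inj₂ near

  iltCover : Cover (ILT G) G
  iltCover = record
    { π       = reduce ∘ splitAt N
    ; emb     = _↑ˡ N
    ; π∘emb   = λ p → cong reduce (splitAt-↑ˡ N p N)
    ; nearπ   = λ {a} {b} → nearReduce (splitAt N a) (splitAt N b)
    ; nearEmb = λ {p} {a} → nearOriginal p a
    }

  -- The fibre over p is {p, p'}, so it avoids any single vertex.
  iltRedundant : Redundant iltCover
  iltRedundant p b with b ≟ p ↑ˡ N
  ... | no b≢p  = p ↑ˡ N , cong reduce (splitAt-↑ˡ N p N) , b≢p ∘ sym
  ... | yes refl = N ↑ʳ p , cong reduce (splitAt-↑ʳ N N p) , clone≢original
    where
    clone≢original : N ↑ʳ p ≢ p ↑ˡ N
    clone≢original e with trans (sym (splitAt-↑ʳ N N p)) (trans (cong (splitAt N) e) (splitAt-↑ˡ N p N))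
    ... | ()

iltTower : ∀ t G → Cover (ILT^ t G) G
iltTower zero    G = idCover G
iltTower (suc t) G = compose (iltCover (ILT^ t G)) (iltTower t G)

iltTower-redundant : ∀ t G → Redundant (iltTower (suc t) G)
iltTower-redundant t G = compose-redundant (iltCover (ILT^ t G)) (iltTower t G) (iltRedundant (ILT^ t G))

exactly : ∀ {G k} → Burnable G k → Minimal G k → BurningNumber G k
exactly (xs , ibs , le) minimal = (xs , ibs , ≤-antisym le (minimal xs ibs)) , minimal

noBurningNumberZero : ∀ G → 0 < n G → ¬ BurningNumber G 0
noBurningNumberZero G nonempty ((xs , (_ , covers) , len) , _) =
  subst (λ r → Burned G xs r (fromℕ< nonempty)) len (covers (fromℕ< nonempty))

theorem23 : (G₀ : Graph) → Connected G₀ → (t k : ℕ) → t ≥ 1 → BurningNumber G₀ k →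
    (GoodOptimal G₀ k → BurningNumber (ILT^ t G₀) k)
    × (¬ GoodOptimal G₀ k → BurningNumber (ILT^ t G₀) (suc k))
theorem23 G₀ (nonempty , _) (suc t) zero    _ bG = ⊥-elim (noBurningNumberZero G₀ nonempty bG)
theorem23 G₀ _              (suc t) (suc m) _ bG@(_ , minimal₀) = goodCase , badCase
  where
  H : Graph
  H = ILT^ (suc t) G₀

  C : Cover H G₀
  C = iltTower (suc t) G₀

  atLeast : Minimal H (suc m)
  atLeast zs ibs with coverLowerBound C ibs
  ... | xs , ibs₀ , le = ≤-trans (minimal₀ xs ibs₀) le

  goodCase : GoodOptimal G₀ (suc m) → BurningNumber H (suc m)
  goodCase good = exactly (spreadBurnable⇒burnable H (liftSpread C (good⇒spread G₀ good))) atLeast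

  -- A burning sequence of H of length b(G₀) would make G₀ good.
  badCase : ¬ GoodOptimal G₀ (suc m) → BurningNumber H (suc (suc m))
  badCase notGood = exactly (spreadBurnable⇒burnable H (liftSpread C (burning⇒spread G₀ bG))) moreThan
    where
    moreThan : Minimal H (suc (suc m))
    moreThan zs ibs with m≤n⇒m<n∨m≡n (atLeast zs ibs)
    ... | inj₁ longer = longer
    ... | inj₂ same   =
      ⊥-elim (notGood (spread⇒good G₀ minimal₀ (dropLastChoice C (iltTower-redundant t G₀) ibs (sym same))))
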